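{- Let $W \ge 1$ and $n \in [1, 2^W)$ be integers, and let $N = n \lfloor 2^W / n \rfloor \in (2^{W-1}, 2^W]$. Let $U \sim \mathrm{Uniform}[0,2^W)$, let $R = \{u \in [0, 2^W) \mid uN \bmod 2^W < 2^W - N\}$, and let $f(u) = u - \lfloor uN / 2^W \rfloor$. Then, conditionally on the event $\{U \in R\}$, $f(U) \sim \mathrm{Uniform}[0, 2^W - N)$.
   Context: $\mathrm{Uniform}[0,m)$ denotes the uniform distribution on $\{0,\dots,m-1\}$; $[0,m)$ denotes $\{0,\dots,m-1\}$. -}

module Defs where

open import Data.Nat using (ℕ; zero; suc; _+_; _*_; _∸_; _^_; _≤_; _<_; NonZero; _<?_; _≟_)
open import Data.Nat.DivMod using (_/_; _%_)
open import Data.Nat.Properties using (m^n≢0)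
open import Data.List using (List; filter; length; upTo)

pow2 : ℕ → ℕ
pow2 W = 2 ^ W

mod2^ : ℕ → ℕ → ℕ
mod2^ W x = _%_ x (2 ^ W) {{m^n≢0 2 W}}

div2^ : ℕ → ℕ → ℕ
div2^ W x = _/_ x (2 ^ W) {{m^n≢0 2 W}}

bigN : (W n : ℕ) → .{{NonZero n}} → ℕ
bigN W n = n * (2 ^ W / n)

setR : (W n : ℕ) → .{{NonZero n}} → List ℕ
setR W n = filter (λ u → mod2^ W (u * bigN W n) <? (2 ^ W ∸ bigN W n)) (upTo (2 ^ W))

fmap : (W n : ℕ) → .{{NonZero n}} → ℕ → ℕ
fmap W n u = u ∸ div2^ W (u * bigN W n)

countR : (W n : ℕ) → .{{NonZero n}} → ℕ → ℕ
countR W n v = length (filter (λ u → fmap W n u ≟ v) (setR W n))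

-- Adding N to uN crosses a multiple of M = 2^W exactly when uN mod M ≥ M − N, so
-- ⌊uN/M⌋ counts the u' < u outside R and f(u) = u − ⌊uN/M⌋ counts those inside R:
-- f is the rank function of R. Hence f maps R (listed increasingly) onto
-- [0, f(M)) = [0, M − N) one-to-one, and every fibre of f over R is a singleton.
module Submission where

open import Defs
open import Data.Nat using (ℕ; zero; suc; _+_; _*_; _∸_; _^_; _≤_; _<_; NonZero; _<?_; _≟_)
open import Data.Nat.Properties
open import Data.Nat.DivMod
open import Data.Nat.Divisibility using (divides-refl)
open import Data.List using ([]; _∷_; [_]; length; filter; map; upTo; _++_)
open import Data.List.Properties
  using (upTo-∷ʳ; filter-++; filter-accept; filter-reject; filter-none; map-++; map-cong;
         length-map; length-++; length-upTo; ++-identityʳ)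
open import Data.List.Relation.Unary.All as All using (All)
open import Data.List.Relation.Unary.All.Properties using (all-upTo)
open import Data.List.Membership.Propositional using (_∈_)
open import Data.List.Membership.Propositional.Properties using (∈-map⁺; ∈-upTo⁻)
open import Data.Product using (_×_; _,_)
open import Data.Sum using (_⊎_; inj₁; inj₂)
open import Data.Bool using (true; false)
open import Function using (_∘_)
open import Relation.Nullary using (¬_; Dec; does; yes; no)
open import Relation.Unary using (Pred; Decidable)
open import Relation.Binary.PropositionalEquality using (_≡_; _≗_; refl; sym; trans; cong; cong₂; subst; module ≡-Reasoning)

map-filter-∘ : ∀ {a b p} {A : Set a} {B : Set b} {P : Pred B p} (P? : Decidable P) (f : A → B) xs →
  map f (filter (P? ∘ f) xs) ≡ filter P? (map f xs)
map-filter-∘ P? f [] = refl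
map-filter-∘ P? f (x ∷ xs) with does (P? (f x))
... | true  = cong (f x ∷_) (map-filter-∘ P? f xs)
... | false = map-filter-∘ P? f xs

filter-≟-upTo : ∀ {v K} → v < K → filter (_≟ v) (upTo K) ≡ [ v ]
filter-≟-upTo {v} {suc K} v<1+K = begin
    filter (_≟ v) (upTo (suc K))
  ≡⟨ cong (filter (_≟ v)) (sym (upTo-∷ʳ K)) ⟩
    filter (_≟ v) (upTo K ++ [ K ])
  ≡⟨ filter-++ (_≟ v) (upTo K) [ K ] ⟩
    filter (_≟ v) (upTo K) ++ filter (_≟ v) [ K ]
  ≡⟨ split (m<1+n⇒m<n∨m≡n v<1+K) ⟩
    [ v ]
  ∎
  where
  open ≡-Reasoning
  split : v < K ⊎ v ≡ K → filter (_≟ v) (upTo K) ++ filter (_≟ v) [ K ] ≡ [ v ]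
  split (inj₁ v<K)  = cong₂ _++_ (filter-≟-upTo v<K) (filter-reject (_≟ v) (>⇒≢ v<K))
  split (inj₂ refl) = cong₂ _++_ (filter-none (_≟ v) (All.map <⇒≢ (all-upTo v))) (filter-accept (_≟ v) refl)

map≡upTo⇒length-fibre≡1 : ∀ {A : Set} (f : A → ℕ) xs {K v} → map f xs ≡ upTo K → v < K →
  length (filter (λ x → f x ≟ v) xs) ≡ 1
map≡upTo⇒length-fibre≡1 f xs {K} {v} fxs≡upTo v<K = begin
    length (filter (λ x → f x ≟ v) xs)
  ≡⟨ sym (length-map f (filter (λ x → f x ≟ v) xs)) ⟩
    length (map f (filter (λ x → f x ≟ v) xs))
  ≡⟨ cong length (map-filter-∘ (_≟ v) f xs) ⟩
    length (filter (_≟ v) (map f xs))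
  ≡⟨ cong (length ∘ filter (_≟ v)) fxs≡upTo ⟩
    length (filter (_≟ v) (upTo K))
  ≡⟨ cong length (filter-≟-upTo v<K) ⟩
    1
  ∎
  where open ≡-Reasoning

module Rank {p} {P : Pred ℕ p} (P? : Decidable P) where

  rank : ℕ → ℕ
  rank m = length (filter P? (upTo m))

  filter-upTo-suc : ∀ m → filter P? (upTo (suc m)) ≡ filter P? (upTo m) ++ filter P? [ m ]
  filter-upTo-suc m = trans (cong (filter P?) (sym (upTo-∷ʳ m))) (filter-++ P? (upTo m) [ m ])

  rank-suc-accept : ∀ {m} → P m → rank (suc m) ≡ suc (rank m)
  rank-suc-accept {m} Pm = begin
      length (filter P? (upTo (suc m)))
    ≡⟨ cong length (filter-upTo-suc m) ⟩
      length (filter P? (upTo m) ++ filter P? [ m ])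
    ≡⟨ cong (λ ys → length (filter P? (upTo m) ++ ys)) (filter-accept P? Pm) ⟩
      length (filter P? (upTo m) ++ [ m ])
    ≡⟨ length-++ (filter P? (upTo m)) ⟩
      rank m + 1
    ≡⟨ +-comm (rank m) 1 ⟩
      suc (rank m)
    ∎
    where open ≡-Reasoning

  rank-suc-reject : ∀ {m} → ¬ P m → rank (suc m) ≡ rank m
  rank-suc-reject {m} ¬Pm = begin
      length (filter P? (upTo (suc m)))
    ≡⟨ cong length (filter-upTo-suc m) ⟩
      length (filter P? (upTo m) ++ filter P? [ m ])
    ≡⟨ cong (λ ys → length (filter P? (upTo m) ++ ys)) (filter-reject P? ¬Pm) ⟩
      length (filter P? (upTo m) ++ [])
    ≡⟨ cong length (++-identityʳ (filter P? (upTo m))) ⟩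
      rank m
    ∎
    where open ≡-Reasoning

  map-rank-filter-upTo : ∀ m → map rank (filter P? (upTo m)) ≡ upTo (rank m)
  map-rank-filter-upTo zero = refl
  map-rank-filter-upTo (suc m) = begin
      map rank (filter P? (upTo (suc m)))
    ≡⟨ cong (map rank) (filter-upTo-suc m) ⟩
      map rank (filter P? (upTo m) ++ filter P? [ m ])
    ≡⟨ map-++ rank (filter P? (upTo m)) (filter P? [ m ]) ⟩
      map rank (filter P? (upTo m)) ++ map rank (filter P? [ m ])
    ≡⟨ cong (_++ map rank (filter P? [ m ])) (map-rank-filter-upTo m) ⟩
      upTo (rank m) ++ map rank (filter P? [ m ])
    ≡⟨ last-step (P? m) ⟩
      upTo (rank (suc m))
    ∎
    where
    open ≡-Reasoning
    last-step : Dec (P m) → upTo (rank m) ++ map rank (filter P? [ m ]) ≡ upTo (rank (suc m))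
    last-step (yes Pm) = begin
        upTo (rank m) ++ map rank (filter P? [ m ])
      ≡⟨ cong (λ ys → upTo (rank m) ++ map rank ys) (filter-accept P? Pm) ⟩
        upTo (rank m) ++ [ rank m ]
      ≡⟨ upTo-∷ʳ (rank m) ⟩
        upTo (suc (rank m))
      ≡⟨ cong upTo (sym (rank-suc-accept Pm)) ⟩
        upTo (rank (suc m))
      ∎
    last-step (no ¬Pm) = begin
        upTo (rank m) ++ map rank (filter P? [ m ])
      ≡⟨ cong (λ ys → upTo (rank m) ++ map rank ys) (filter-reject P? ¬Pm) ⟩
        upTo (rank m) ++ []
      ≡⟨ ++-identityʳ (upTo (rank m)) ⟩
        upTo (rank m)
      ≡⟨ cong upTo (sym (rank-suc-reject ¬Pm)) ⟩
        upTo (rank (suc m))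
      ∎

module MultiplyShift (M N : ℕ) .{{_ : NonZero M}} (N≤M : N ≤ M) where

  NoCarry : ℕ → Set
  NoCarry u = (u * N) % M < M ∸ N

  noCarry? : Decidable NoCarry
  noCarry? u = (u * N) % M <? M ∸ N

  open Rank noCarry?

  f : ℕ → ℕ
  f u = u ∸ (u * N) / M

  [1+u]N/M≡uN/M+carry : ∀ u → (suc u * N) / M ≡ (u * N) / M + ((u * N) % M + N) / M
  [1+u]N/M≡uN/M+carry u = begin
      (N + u * N) / M
    ≡⟨ cong (λ x → (N + x) / M) (m≡m%n+[m/n]*n (u * N) M) ⟩
      (N + ((u * N) % M + (u * N) / M * M)) / M
    ≡⟨ cong (_/ M) (sym (+-assoc N ((u * N) % M) _)) ⟩
      (N + (u * N) % M + (u * N) / M * M) / M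
    ≡⟨ +-distrib-/-∣ʳ (N + (u * N) % M) (divides-refl ((u * N) / M)) ⟩
      (N + (u * N) % M) / M + (u * N) / M * M / M
    ≡⟨ cong₂ _+_ (cong (_/ M) (+-comm N ((u * N) % M))) (m*n/n≡m ((u * N) / M) M) ⟩
      ((u * N) % M + N) / M + (u * N) / M
    ≡⟨ +-comm _ ((u * N) / M) ⟩
      (u * N) / M + ((u * N) % M + N) / M
    ∎
    where open ≡-Reasoning

  carry-noCarry : ∀ {u} → NoCarry u → ((u * N) % M + N) / M ≡ 0
  carry-noCarry {u} r<M∸N = m<n⇒m/n≡0 (subst ((u * N) % M + N <_) (m∸n+n≡m N≤M) (+-monoˡ-< N r<M∸N))

  carry-¬noCarry : ∀ {u} → ¬ NoCarry u → ((u * N) % M + N) / M ≡ 1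
  carry-¬noCarry {u} r≮M∸N = trans (m/n≡1+[m∸n]/n M≤r+N) (cong suc (m<n⇒m/n≡0 r+N∸M<M))
    where
    M≤r+N : M ≤ (u * N) % M + N
    M≤r+N = subst (_≤ (u * N) % M + N) (m∸n+n≡m N≤M) (+-monoˡ-≤ N (≮⇒≥ r≮M∸N))
    r+N∸M<M : (u * N) % M + N ∸ M < M
    r+N∸M<M = m<n+o⇒m∸n<o _ M (+-mono-<-≤ (m%n<n (u * N) M) N≤M)

  uN/M≤u : ∀ u → (u * N) / M ≤ u
  uN/M≤u u = subst ((u * N) / M ≤_) (m*n/n≡m u M) (/-monoˡ-≤ M (*-monoʳ-≤ u N≤M))

  f≗rank : f ≗ rank
  f≗rank zero = cong (0 ∸_) (0/n≡0 M)
  f≗rank (suc u) with noCarry? u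
  ... | yes r<M∸N = begin
      suc u ∸ (suc u * N) / M
    ≡⟨ cong (suc u ∸_) ([1+u]N/M≡uN/M+carry u) ⟩
      suc u ∸ ((u * N) / M + ((u * N) % M + N) / M)
    ≡⟨ cong (λ c → suc u ∸ ((u * N) / M + c)) (carry-noCarry {u} r<M∸N) ⟩
      suc u ∸ ((u * N) / M + 0)
    ≡⟨ cong (suc u ∸_) (+-identityʳ ((u * N) / M)) ⟩
      suc u ∸ (u * N) / M
    ≡⟨ +-∸-assoc 1 {u} (uN/M≤u u) ⟩
      suc (f u)
    ≡⟨ cong suc (f≗rank u) ⟩
      suc (rank u)
    ≡⟨ rank-suc-accept r<M∸N ⟨
      rank (suc u)
    ∎
    where open ≡-Reasoning
  ... | no r≮M∸N = begin
      suc u ∸ (suc u * N) / M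
    ≡⟨ cong (suc u ∸_) ([1+u]N/M≡uN/M+carry u) ⟩
      suc u ∸ ((u * N) / M + ((u * N) % M + N) / M)
    ≡⟨ cong (λ c → suc u ∸ ((u * N) / M + c)) (carry-¬noCarry {u} r≮M∸N) ⟩
      suc u ∸ ((u * N) / M + 1)
    ≡⟨ cong (suc u ∸_) (+-comm ((u * N) / M) 1) ⟩
      f u
    ≡⟨ f≗rank u ⟩
      rank u
    ≡⟨ rank-suc-reject r≮M∸N ⟨
      rank (suc u)
    ∎
    where open ≡-Reasoning

  f[M]≡M∸N : f M ≡ M ∸ N
  f[M]≡M∸N = cong (M ∸_) (trans (cong (_/ M) (*-comm M N)) (m*n/n≡m N M))

  map-f-filter-noCarry : map f (filter noCarry? (upTo M)) ≡ upTo (M ∸ N)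
  map-f-filter-noCarry = begin
      map f (filter noCarry? (upTo M))
    ≡⟨ map-cong f≗rank (filter noCarry? (upTo M)) ⟩
      map rank (filter noCarry? (upTo M))
    ≡⟨ map-rank-filter-upTo M ⟩
      upTo (rank M)
    ≡⟨ cong upTo (trans (sym (f≗rank M)) f[M]≡M∸N) ⟩
      upTo (M ∸ N)
    ∎
    where open ≡-Reasoning

proposition4p1 : (W n : ℕ) → 1 ≤ W → .{{_ : NonZero n}} → n < 2 ^ W →
    ((u : ℕ) → u ∈ setR W n → fmap W n u < 2 ^ W ∸ bigN W n)
    × ((v : ℕ) → v < 2 ^ W ∸ bigN W n →
        countR W n v * (2 ^ W ∸ bigN W n) ≡ length (setR W n))
proposition4p1 W n _ _ = f-bounded , fibres-equal
  where
  N≤2^W : bigN W n ≤ 2 ^ W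
  N≤2^W = subst (_≤ 2 ^ W) (*-comm (2 ^ W / n) n) (m/n*n≤m (2 ^ W) n)

  open MultiplyShift (2 ^ W) (bigN W n) {{m^n≢0 2 W}} N≤2^W

  f-bounded : (u : ℕ) → u ∈ setR W n → f u < 2 ^ W ∸ bigN W n
  f-bounded u u∈R = ∈-upTo⁻ (subst (f u ∈_) map-f-filter-noCarry (∈-map⁺ f u∈R))

  fibres-equal : (v : ℕ) → v < 2 ^ W ∸ bigN W n →
    countR W n v * (2 ^ W ∸ bigN W n) ≡ length (setR W n)
  fibres-equal v v<M∸N = begin
      countR W n v * (2 ^ W ∸ bigN W n)
    ≡⟨ cong (_* _) (map≡upTo⇒length-fibre≡1 f (setR W n) map-f-filter-noCarry v<M∸N) ⟩
      1 * (2 ^ W ∸ bigN W n)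
    ≡⟨ *-identityˡ _ ⟩
      2 ^ W ∸ bigN W n
    ≡⟨ length-upTo _ ⟨
      length (upTo (2 ^ W ∸ bigN W n))
    ≡⟨ cong length map-f-filter-noCarry ⟨
      length (map f (setR W n))
    ≡⟨ length-map f (setR W n) ⟩
      length (setR W n)
    ∎
    where open ≡-Reasoning
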